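{- Let $G$ be a finite, simple, connected graph and let $r \in V(G)$. Run the twice-degree algorithm (described in the context) on input $(G,r)$, and let $s : V(G) \to \mathbb{Z}^+$ be the coloring it returns and $T = (V_T, E_T)$ the tree it has built when it terminates. Then $s$ is a $T$-pseudo-schedule of $G$.
   Context: Graphs are simple and undirected; $N_G[v]$ denotes the closed neighborhood of $v$ in $G$ ($v$ together with all its neighbors), and $\dist_G(u,v)$ the graph distance. Conflict notions. Let $l : V \to \mathbb{Z}$ be a vertex coloring of a graph $G=(V,E)$. An ordered pair $(u,v) \in V^2$ is nonconflicting iff $uv \in E$, $l(u) \neq l(v)$, and $l(u) \neq l(x)$ for every $x \neq u$ adjacent to $v$. A directed path is nonconflicting iff each consecutive ordered pair along it is nonconflicting. A pseudo-schedule of $G$ is a coloring such that for all $u, v$ connected in $G$ there exists at least one nonconflicting directed path from $u$ to $v$. An edge $uv$ is bidirectional iff both $(u,v)$ and $(v,u)$ are nonconflicting; a subgraph is bidirectional iff all its edges are. For a subgraph $H$, an $H$-pseudo-schedule is a pseudo-schedule of $G$ under which $H$ is bidirectional. Trees. For a tree $T$ rooted at $r$, $u$ is the parent of $v$ (written $u = \mathrm{parent}_{T,r}(v)$) iff $uv \in E(T)$ and $\dist_T(u,r) < \dist_T(v,r)$; by convention $\mathrm{parent}_{T,r}(r) = r$. For a partially defined coloring $s$ and a vertex set $U$, $s(U)$ denotes $\{s(u) : u \in U,\ s(u)\text{ is defined}\}$. The twice-degree algorithm, on input $(G,r)$: Initialize $V_T \gets \{r\}$, $E_T \gets \emptyset$,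 $T = (V_T,E_T)$ (always referring to the current sets), a FIFO queue $Q \gets (r)$, an empty queue $Q'$, and the empty partial coloring $s$. Repeat the following until $Q$ is empty: for each $v$ in $Q$, in FIFO order: (1) let $N \gets N_G[v] \setminus V_T$; (2) append the elements of $N$ to $Q'$ in any order; (3) $V_T \gets V_T \cup N$ and $E_T \gets E_T \cup \{vx : x \in N\}$; (4) let $K \gets s(N_G[\mathrm{parent}_{T,r}(v)])$ (computed in the current tree); (5) for each $x \in N_G[v]$ with $x \neq v$ and $vx \notin E_T$, add $s(\mathrm{parent}_{T,r}(x))$ to $K$ if it is defined; (6) let $k$ be the least positive integer not in $K$ and set $s(v) \gets k$. After processing all of $Q$, set $Q \gets Q'$ and $Q' \gets$ empty. When the loop ends, return $s$. -}

module Defs where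

open import Data.Nat using (ℕ; zero; suc; _≤_; _<_; _+_)
open import Data.Integer using (ℤ; +_)
open import Data.Fin using (Fin)
open import Data.Bool using (Bool; true; false)
open import Data.Maybe using (Maybe; just; nothing)
open import Data.List using (List; []; _∷_; _++_; map)
open import Data.List.Membership.Propositional using (_∈_; _∉_)
open import Data.List.Relation.Unary.Unique.Propositional using (Unique)
open import Data.Product using (Σ; ∃; ∃-syntax; _×_; _,_)
open import Data.Sum using (_⊎_)
open import Relation.Nullary using (¬_)
open import Relation.Binary.PropositionalEquality using (_≡_; _≢_)
open import Relation.Binary.Construct.Closure.ReflexiveTransitive using (Star)
open import Function.Bundles using (_⇔_)

record Graph (n : ℕ) : Set where
  field
    adj       : Fin n → Fin n → Bool
    adj-sym   : ∀ u v → adj u v ≡ adj v u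
    adj-irrefl : ∀ v → adj v v ≡ false
open Graph public

Adj : ∀ {n} → Graph n → Fin n → Fin n → Set
Adj G u v = adj G u v ≡ true

InClosedNbhd : ∀ {n} → Graph n → Fin n → Fin n → Set
InClosedNbhd G v x = x ≡ v ⊎ Adj G v x

data Chain {n : ℕ} (R : Fin n → Fin n → Set) : Fin n → Fin n → List (Fin n) → Set where
  here : ∀ {u} → Chain R u u (u ∷ [])
  step : ∀ {u w v xs} → R u w → Chain R w v xs → Chain R u v (u ∷ xs)

ConnectedIn : ∀ {n} → Graph n → Fin n → Fin n → Set
ConnectedIn G u v = ∃[ xs ] Chain (Adj G) u v xs

IsConnected : ∀ {n} → Graph n → Set
IsConnected G = ∀ u v → ConnectedIn G u v

NonConflicting : ∀ {n} → Graph n → (Fin n → ℤ) → Fin n → Fin n → Set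
NonConflicting G l u v =
  Adj G u v × l u ≢ l v × (∀ x → x ≢ u → Adj G x v → l u ≢ l x)

NCPath : ∀ {n} → Graph n → (Fin n → ℤ) → Fin n → Fin n → Set
NCPath G l u v = ∃[ xs ] (Chain (NonConflicting G l) u v xs × Unique xs)

PseudoSchedule : ∀ {n} → Graph n → (Fin n → ℤ) → Set
PseudoSchedule G l = ∀ u v → ConnectedIn G u v → NCPath G l u v

-- a subgraph given by its edge list (unordered edges {a,b} stored as (a , b))
Bidirectional : ∀ {n} → Graph n → (Fin n → ℤ) → List (Fin n × Fin n) → Set
Bidirectional G l E =
  ∀ a b → (a , b) ∈ E → NonConflicting G l a b × NonConflicting G l b a

HPseudoSchedule : ∀ {n} → Graph n → List (Fin n × Fin n) → (Fin n → ℤ) → Set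
HPseudoSchedule G E l = PseudoSchedule G l × Bidirectional G l E

TEdge : ∀ {n} → List (Fin n × Fin n) → Fin n → Fin n → Set
TEdge E a b = (a , b) ∈ E ⊎ (b , a) ∈ E

data TWalk {n : ℕ} (E : List (Fin n × Fin n)) : Fin n → Fin n → ℕ → Set where
  here : ∀ {u} → TWalk E u u 0
  step : ∀ {u w v d} → TEdge E u w → TWalk E w v d → TWalk E u v (suc d)

Dist : ∀ {n} → List (Fin n × Fin n) → Fin n → Fin n → ℕ → Set
Dist E u v d = TWalk E u v d × (∀ d' → TWalk E u v d' → d ≤ d')

-- p = parent_{T,r}(v), with the convention parent(r) = r
IsParent : ∀ {n} → List (Fin n × Fin n) → Fin n → Fin n → Fin n → Set
IsParent E r p v =
  (p ≡ r × v ≡ r)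
  ⊎ (TEdge E p v × ∃[ dp ] ∃[ dv ] (Dist E p r dp × Dist E v r dv × dp < dv))

-- The twice-degree algorithm, as a (nondeterministic) transition system

record State (n : ℕ) : Set where
  constructor mkState
  field
    Q  : List (Fin n)
    Q' : List (Fin n)
    VT : List (Fin n)
    ET : List (Fin n × Fin n)
    s  : Fin n → Maybe ℕ
open State public

initState : ∀ {n} → Fin n → State n
initState r = mkState (r ∷ []) [] (r ∷ []) [] (λ _ → nothing)

update : ∀ {n} → (Fin n → Maybe ℕ) → Fin n → ℕ → Fin n → Maybe ℕ
update s v k x with x Data.Fin.≟ v
... | Relation.Nullary.yes _ = just k
... | Relation.Nullary.no _ = s x

InK : ∀ {n} → Graph n → Fin n → List (Fin n × Fin n) → (Fin n → Maybe ℕ)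
      → Fin n → ℕ → Set
InK G r E s v c =
  -- step (4): c ∈ s(N_G[parent(v)])
  (∃[ p ] (IsParent E r p v × ∃[ y ] (InClosedNbhd G p y × s y ≡ just c)))
  -- step (5): c = s(parent(x)) for x ∈ N_G[v], x ≠ v, vx ∉ E_T
  ⊎ (∃[ x ] (InClosedNbhd G v x × x ≢ v × ¬ TEdge E v x
             × ∃[ p ] (IsParent E r p x × s p ≡ just c)))

LeastPositiveNotIn : (ℕ → Set) → ℕ → Set
LeastPositiveNotIn K k = 1 ≤ k × ¬ K k × (∀ j → 1 ≤ j → j < k → K j)

data Step {n : ℕ} (G : Graph n) (r : Fin n) : State n → State n → Set where
  -- process the head v of Q; L is N_G[v] ∖ V_T listed in an arbitrary order
  process : ∀ {v rest Q' VT ET s} (L : List (Fin n)) (k : ℕ)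
    → Unique L
    → (∀ x → x ∈ L ⇔ (InClosedNbhd G v x × x ∉ VT))
    → LeastPositiveNotIn (InK G r (ET ++ map (v ,_) L) s v) k
    → Step G r (mkState (v ∷ rest) Q' VT ET s)
               (mkState rest (Q' ++ L) (VT ++ L) (ET ++ map (v ,_) L) (update s v k))
  swap : ∀ {x Q'' VT ET s}
    → Step G r (mkState [] (x ∷ Q'') VT ET s) (mkState (x ∷ Q'') [] VT ET s)

Run : ∀ {n} → Graph n → Fin n → State n → Set
Run G r fin = Star (Step G r) (initState r) fin × Q fin ≡ [] × Q' fin ≡ []

module Submission where

-- The algorithm is a breadth-first search that colours each vertex when it is
-- dequeued.  Along the run we maintain that the processed vertices form a prefix of
-- the discovery list V_T, that exactly they are coloured, that T is a BFS tree with
-- levels, and that for every tree edge pv (p the parent) the colour of p differs from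
-- the colours of v and of every other neighbour of v, while the colour of v differs
-- from the colours of every other neighbour of p -- whenever both colours are defined.
-- When w receives its colour k, each such constraint between w and an earlier
-- coloured vertex is one of the colours excluded from k in step (4) or (5), with one
-- exception: for an earlier tree edge pv with pw a non-tree edge, BFS discovered w
-- before v, so v cannot be coloured already.  At termination every vertex is
-- coloured, so all tree edges are bidirectional, and two vertices are joined by a
-- nonconflicting path through the root once loops are erased.

open import Defs
open import Data.Nat using (ℕ; suc; _≤_; z≤n; s≤s)
open import Data.Nat.Properties using (≤-refl; n≤1+n; module ≤-Reasoning)
open import Data.Integer using (ℤ; +_)
open import Data.Integer.Properties using (+-injective)
open import Data.Fin using (Fin; _≟_)
open import Data.Maybe using (Maybe; just; nothing)
open import Data.Product using (Σ; _×_; _,_; ∃₂; ∃-syntax; proj₁; proj₂)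
open import Data.Product.Properties using (≡-dec)
open import Data.Sum using (_⊎_; inj₁; inj₂)
open import Data.Empty using (⊥-elim)
open import Data.List using (List; []; _∷_; _++_; map)
open import Data.List.Properties using (++-assoc; ++-identityʳ; ∷-injective)
open import Data.List.Membership.Propositional using (_∈_; _∉_)
open import Data.List.Membership.Propositional.Properties
  using (∈-++⁺ˡ; ∈-++⁺ʳ; ∈-++⁻; ∈-map⁺; ∈-map⁻)
open import Data.List.Relation.Unary.Any using (here; there)
open import Data.List.Relation.Unary.All as All using ()
open import Data.List.Relation.Unary.AllPairs using ([]; _∷_)
open import Data.List.Relation.Unary.All.Properties.Core using (¬Any⇒All¬)
open import Data.List.Relation.Unary.Unique.Propositional using (Unique)
open import Data.List.Relation.Unary.Unique.Propositional.Properties using (++⁺)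
open import Data.List.Relation.Binary.Disjoint.Propositional using (Disjoint)
import Data.List.Membership.DecPropositional as DecMembership
open import Relation.Nullary using (¬_; yes; no)
open import Relation.Binary.PropositionalEquality
  using (_≡_; _≢_; refl; sym; trans; cong; subst; module ≡-Reasoning)
open import Relation.Binary.Construct.Closure.ReflexiveTransitive using (Star; ε; _◅_)
open import Function.Bundles using (_⇔_; Equivalence)

module _ {n : ℕ} where
  open DecMembership {A = Fin n} _≟_ public using (_∈?_)
  open DecMembership {A = Fin n × Fin n} (≡-dec _≟_ _≟_) public using () renaming (_∈?_ to _∈ᴱ?_)

module _ {A : Set} where

  ++⁻-disjoint : ∀ (xs : List A) {ys} → Unique (xs ++ ys) → Disjoint xs ys
  ++⁻-disjoint (a ∷ xs) (a∉ ∷ _) (here refl , y∈ys) = All.lookup a∉ (∈-++⁺ʳ xs y∈ys) refl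
  ++⁻-disjoint (a ∷ xs) (_ ∷ u) (there x∈xs , y∈ys) = ++⁻-disjoint xs u (x∈xs , y∈ys)

  ++-≡-++⁻ : ∀ (ys : List A) {zs as bs} → ys ++ zs ≡ as ++ bs
    → (∃[ m ] (as ≡ ys ++ m × zs ≡ m ++ bs)) ⊎ (∃[ m ] (ys ≡ as ++ m × bs ≡ m ++ zs))
  ++-≡-++⁻ [] eq = inj₁ (_ , refl , eq)
  ++-≡-++⁻ (y ∷ ys) {as = []} eq = inj₂ (y ∷ ys , refl , sym eq)
  ++-≡-++⁻ (y ∷ ys) {as = a ∷ as} eq with ∷-injective eq
  ... | refl , eq′ with ++-≡-++⁻ ys eq′
  ... | inj₁ (m , e₁ , e₂) = inj₁ (m , cong (y ∷_) e₁ , e₂)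
  ... | inj₂ (m , e₁ , e₂) = inj₂ (m , cong (y ∷_) e₁ , e₂)

  Precedes : List A → A → A → Set
  Precedes xs x y = ∃₂ λ ys zs → xs ≡ ys ++ zs × x ∈ ys × y ∈ zs

  precedes-++ʳ : ∀ {xs} zs {x y} → Precedes xs x y → Precedes (xs ++ zs) x y
  precedes-++ʳ zs (ys , ys′ , refl , x∈ , y∈) =
    ys , ys′ ++ zs , ++-assoc ys ys′ zs , x∈ , ∈-++⁺ˡ y∈

  precedes-++⁻ : ∀ as {bs x y} → Unique (as ++ bs) → Precedes (as ++ bs) x y → y ∈ as → x ∉ bs
  precedes-++⁻ as u (ys , zs , eq , x∈ys , y∈zs) y∈as x∈bs with ++-≡-++⁻ ys {as = as} (sym eq)
  ... | inj₁ (m , refl , _) = ++⁻-disjoint as u (∈-++⁺ˡ x∈ys , x∈bs)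
  ... | inj₂ (m , refl , refl) = ++⁻-disjoint as u (y∈as , ∈-++⁺ʳ m y∈zs)

module _ {n : ℕ} {R : Fin n → Fin n → Set} where

  Chain-++ : ∀ {u w v xs ys} → Chain R u w xs → Chain R w v ys → ∃[ zs ] Chain R u v zs
  Chain-++ here c = _ , c
  Chain-++ (step r c) c′ = _ , step r (proj₂ (Chain-++ c c′))

  Chain-reverse : (∀ {a b} → R a b → R b a)
    → ∀ {u v xs} → Chain R u v xs → ∃[ ys ] Chain R v u ys
  Chain-reverse sym-R here = _ , here
  Chain-reverse sym-R (step r c) = Chain-++ (proj₂ (Chain-reverse sym-R c)) (step (sym-R r) here)

  Chain-suffix : ∀ {w v ys u} → Chain R w v ys → Unique ys → u ∈ ys
    → ∃[ zs ] (Chain R u v zs × Unique zs)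
  Chain-suffix here u (here refl) = _ , here , u
  Chain-suffix c@(step _ _) u (here refl) = _ , c , u
  Chain-suffix (step _ c) (_ ∷ u) (there u∈) = Chain-suffix c u u∈

  Chain-eraseLoops : ∀ {u v xs} → Chain R u v xs → ∃[ ys ] (Chain R u v ys × Unique ys)
  Chain-eraseLoops here = _ , here , (All.[] ∷ [])
  Chain-eraseLoops {u} (step r c) with Chain-eraseLoops c
  ... | ys , c′ , uq with u ∈? ys
  ...   | yes u∈ = Chain-suffix c′ uq u∈
  ...   | no u∉ = u ∷ ys , step r c′ , (¬Any⇒All¬ ys u∉ ∷ uq)

Chain-map : ∀ {n} {R S : Fin n → Fin n → Set} → (∀ {a b} → R a b → S a b)
  → ∀ {u v xs} → Chain R u v xs → Chain S u v xs
Chain-map f here = here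
Chain-map f (step r c) = step (f r) (Chain-map f c)

module _ {n : ℕ} {E : List (Fin n × Fin n)} where

  TEdge-sym : ∀ {a b} → TEdge E a b → TEdge E b a
  TEdge-sym (inj₁ e) = inj₂ e
  TEdge-sym (inj₂ e) = inj₁ e

  TWalk⇒Chain : ∀ {u v d} → TWalk E u v d → ∃[ xs ] Chain (TEdge E) u v xs
  TWalk⇒Chain here = _ , here
  TWalk⇒Chain (step e w) = _ , step e (proj₂ (TWalk⇒Chain w))

  TWalk-++ʳ : ∀ M {u v d} → TWalk E u v d → TWalk (E ++ M) u v d
  TWalk-++ʳ M here = here
  TWalk-++ʳ M (step (inj₁ e) w) = step (inj₁ (∈-++⁺ˡ e)) (TWalk-++ʳ M w)
  TWalk-++ʳ M (step (inj₂ e) w) = step (inj₂ (∈-++⁺ˡ e)) (TWalk-++ʳ M w)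

∈-++-map⁻ : ∀ {n} {E : List (Fin n × Fin n)} {w L a b}
  → (a , b) ∈ E ++ map (w ,_) L → (a , b) ∈ E ⊎ (a ≡ w × b ∈ L)
∈-++-map⁻ {E = E} e with ∈-++⁻ E e
... | inj₁ e′ = inj₁ e′
... | inj₂ e′ with ∈-map⁻ _ e′
... | _ , b∈ , refl = inj₂ (refl , b∈)

record Levelling {n : ℕ} (r : Fin n) (V : List (Fin n)) (E : List (Fin n × Fin n))
                 (level : Fin n → ℕ) : Set where
  field
    root∈V      : r ∈ V
    level-root  : level r ≡ 0
    level-edge  : ∀ {a b} → (a , b) ∈ E → level b ≡ suc (level a)
    walk-root   : ∀ {x} → x ∈ V → TWalk E x r (level x)
    edge-source : ∀ {a b} → (a , b) ∈ E → a ∈ V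
    edge-target : ∀ {a b} → (a , b) ∈ E → b ∈ V

module _ {n : ℕ} {r : Fin n} {V E level} (T : Levelling r V E level) where
  open Levelling T

  level≤walk : ∀ {x d} → TWalk E x r d → level x ≤ d
  level≤walk here = subst (_≤ 0) (sym level-root) z≤n
  level≤walk (step {u} {u′} {d = d} (inj₁ e) w) = begin
    level u        ≤⟨ n≤1+n (level u) ⟩
    suc (level u)  ≡⟨ level-edge e ⟨
    level u′       ≤⟨ level≤walk w ⟩
    d              ≤⟨ n≤1+n d ⟩
    suc d          ∎
    where open ≤-Reasoning
  level≤walk (step (inj₂ e) w) = subst (_≤ _) (sym (level-edge e)) (s≤s (level≤walk w))

  level-dist : ∀ {x} → x ∈ V → Dist E x r (level x)
  level-dist x∈ = walk-root x∈ , λ _ → level≤walk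

  edge⇒parent : ∀ {a b} → (a , b) ∈ E → IsParent E r a b
  edge⇒parent e = inj₂ (inj₁ e , _ , _ , level-dist (edge-source e) , level-dist (edge-target e) ,
                         subst (suc (level _) ≤_) (sym (level-edge e)) ≤-refl)

  module _ {w L} (w∈V : w ∈ V) (L#V : Disjoint L V) where

    extended-level : Fin n → ℕ
    extended-level x with x ∈? L
    ... | yes _ = suc (level w)
    ... | no _ = level x

    extended-level-new : ∀ {x} → x ∈ L → extended-level x ≡ suc (level w)
    extended-level-new {x} x∈L with x ∈? L
    ... | yes _ = refl
    ... | no x∉L = ⊥-elim (x∉L x∈L)

    extended-level-old : ∀ {x} → x ∈ V → extended-level x ≡ level x
    extended-level-old {x} x∈V with x ∈? L
    ... | yes x∈L = ⊥-elim (L#V (x∈L , x∈V))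
    ... | no _ = refl

    Levelling-extend : Levelling r (V ++ L) (E ++ map (w ,_) L) extended-level
    Levelling-extend = record
      { root∈V = ∈-++⁺ˡ root∈V
      ; level-root = trans (extended-level-old root∈V) level-root
      ; level-edge = level-edge′ ; walk-root = walk-root′
      ; edge-source = edge-source′ ; edge-target = edge-target′ }
      where
      level-edge′ : ∀ {a b} → (a , b) ∈ E ++ map (w ,_) L
        → extended-level b ≡ suc (extended-level a)
      level-edge′ e with ∈-++-map⁻ e
      ... | inj₁ e′ = trans (extended-level-old (edge-target e′))
                        (trans (level-edge e′) (cong suc (sym (extended-level-old (edge-source e′)))))
      ... | inj₂ (refl , b∈L) =
        trans (extended-level-new b∈L) (cong suc (sym (extended-level-old w∈V)))
      walk-root′ : ∀ {x} → x ∈ V ++ L → TWalk (E ++ map (w ,_) L) x r (extended-level x)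
      walk-root′ {x} x∈ with ∈-++⁻ V x∈
      ... | inj₁ x∈V =
        subst (TWalk _ x r) (sym (extended-level-old x∈V)) (TWalk-++ʳ _ (walk-root x∈V))
      ... | inj₂ x∈L = subst (TWalk _ x r) (sym (extended-level-new x∈L))
                         (step (inj₂ (∈-++⁺ʳ E (∈-map⁺ _ x∈L))) (TWalk-++ʳ _ (walk-root w∈V)))
      edge-source′ : ∀ {a b} → (a , b) ∈ E ++ map (w ,_) L → a ∈ V ++ L
      edge-source′ e with ∈-++-map⁻ e
      ... | inj₁ e′ = ∈-++⁺ˡ (edge-source e′)
      ... | inj₂ (refl , _) = ∈-++⁺ˡ w∈V
      edge-target′ : ∀ {a b} → (a , b) ∈ E ++ map (w ,_) L → b ∈ V ++ L
      edge-target′ e with ∈-++-map⁻ e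
      ... | inj₁ e′ = ∈-++⁺ˡ (edge-target e′)
      ... | inj₂ (refl , b∈L) = ∈-++⁺ʳ V b∈L

Adj-sym : ∀ {n} (G : Graph n) {a b} → Adj G a b → Adj G b a
Adj-sym G {a} {b} ab = trans (adj-sym G b a) ab

Adj⇒≢ : ∀ {n} (G : Graph n) {a b} → Adj G a b → a ≢ b
Adj⇒≢ G {a} aa refl with trans (sym (adj-irrefl G a)) aa
... | ()

Apart : ∀ {n} → (Fin n → Maybe ℕ) → Fin n → Fin n → Set
Apart s x y = ∀ a b → s x ≡ just a → s y ≡ just b → a ≢ b

module _ {n : ℕ} (s : Fin n → Maybe ℕ) (w : Fin n) (k : ℕ) where

  update-≡ : update s w k w ≡ just k
  update-≡ with w ≟ w
  ... | yes _ = refl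
  ... | no w≢w = ⊥-elim (w≢w refl)

  update-≢ : ∀ {y} → y ≢ w → update s w k y ≡ s y
  update-≢ {y} y≢w with y ≟ w
  ... | yes y≡w = ⊥-elim (y≢w y≡w)
  ... | no _ = refl

  update⁻ : ∀ y {c} → update s w k y ≡ just c → (y ≡ w × c ≡ k) ⊎ (y ≢ w × s y ≡ just c)
  update⁻ y e with y ≟ w
  update⁻ y refl | yes refl = inj₁ (refl , refl)
  ... | no y≢w = inj₂ (y≢w , e)

-- The invariant of the run

record Invariant {n : ℕ} (G : Graph n) (r : Fin n) (st : State n) : Set where
  field
    processed              : List (Fin n)
    level                  : Fin n → ℕ
    tree-split             : VT st ≡ processed ++ (Q st ++ Q' st)
    tree-unique            : Unique (VT st)
    processed-coloured     : ∀ {x} → x ∈ processed → ∃[ c ] (s st x ≡ just c × 1 ≤ c)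
    unprocessed-uncoloured : ∀ {x} → x ∉ processed → s st x ≡ nothing
    levelling              : Levelling r (VT st) (ET st) level
    parent-processed       : ∀ {p v} → (p , v) ∈ ET st → p ∈ processed
    tree-edge-adjacent     : ∀ {p v} → (p , v) ∈ ET st → Adj G p v
    processed-closed       : ∀ {y} x → y ∈ processed → Adj G y x → x ∈ VT st
    nontree-precedes       : ∀ {p v} x → (p , v) ∈ ET st → Adj G p x → (p , x) ∉ ET st
                             → Precedes (VT st) x v
    parent-apart           : ∀ {p v} → (p , v) ∈ ET st → Apart (s st) p v
    down-apart             : ∀ {p v} x → (p , v) ∈ ET st → Adj G x v → x ≢ p → Apart (s st) p x
    up-apart               : ∀ {p v} x → (p , v) ∈ ET st → Adj G x p → x ≢ v → Apart (s st) v x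

  coloured⇒processed : ∀ {x c} → s st x ≡ just c → x ∈ processed
  coloured⇒processed {x} sx with x ∈? processed
  ... | yes x∈ = x∈
  ... | no x∉ with trans (sym sx) (unprocessed-uncoloured x∉)
  ... | ()

initial-invariant : ∀ {n} (G : Graph n) (r : Fin n) → Invariant G r (initState r)
initial-invariant G r = record
  { processed = [] ; level = λ _ → 0 ; tree-split = refl ; tree-unique = All.[] ∷ []
  ; processed-coloured = λ () ; unprocessed-uncoloured = λ _ → refl
  ; levelling = record { root∈V = here refl ; level-root = refl ; level-edge = λ ()
                       ; walk-root = λ { (here refl) → here }
                       ; edge-source = λ () ; edge-target = λ () }
  ; parent-processed = λ () ; tree-edge-adjacent = λ () ; processed-closed = λ _ ()
  ; nontree-precedes = λ _ () ; parent-apart = λ () ; down-apart = λ _ ()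
  ; up-apart = λ _ () }

swap-invariant : ∀ {n} {G : Graph n} {r x Q'' VT ET s}
  → Invariant G r (mkState [] (x ∷ Q'') VT ET s)
  → Invariant G r (mkState (x ∷ Q'') [] VT ET s)
swap-invariant {x = x} {Q''} I = record
  { processed = processed ; level = level
  ; tree-split = trans tree-split (cong (processed ++_) (sym (++-identityʳ (x ∷ Q''))))
  ; tree-unique = tree-unique ; processed-coloured = processed-coloured
  ; unprocessed-uncoloured = unprocessed-uncoloured ; levelling = levelling
  ; parent-processed = parent-processed ; tree-edge-adjacent = tree-edge-adjacent
  ; processed-closed = processed-closed ; nontree-precedes = nontree-precedes
  ; parent-apart = parent-apart ; down-apart = down-apart ; up-apart = up-apart }
  where open Invariant I

-- Processing a vertex

module Process {n : ℕ} {G : Graph n} {r w : Fin n} {rest Q' VT : List (Fin n)}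
  {ET : List (Fin n × Fin n)} {s : Fin n → Maybe ℕ} (L : List (Fin n)) (k : ℕ)
  (L-unique : Unique L) (L-spec : ∀ x → x ∈ L ⇔ (InClosedNbhd G w x × x ∉ VT))
  (k-least : LeastPositiveNotIn (InK G r (ET ++ map (w ,_) L) s w) k)
  (I : Invariant G r (mkState (w ∷ rest) Q' VT ET s)) where

  open Invariant I
  open Levelling levelling

  VT′ : List (Fin n)
  VT′ = VT ++ L

  ET′ : List (Fin n × Fin n)
  ET′ = ET ++ map (w ,_) L

  s′ : Fin n → Maybe ℕ
  s′ = update s w k

  processed′ : List (Fin n)
  processed′ = processed ++ w ∷ []

  L⊆N[w] : ∀ {x} → x ∈ L → InClosedNbhd G w x
  L⊆N[w] x∈L = proj₁ (Equivalence.to (L-spec _) x∈L)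

  L#VT : Disjoint L VT
  L#VT (x∈L , x∈VT) = proj₂ (Equivalence.to (L-spec _) x∈L) x∈VT

  N[w]∖VT⊆L : ∀ {x} → InClosedNbhd G w x → x ∉ VT → x ∈ L
  N[w]∖VT⊆L x∈N x∉VT = Equivalence.from (L-spec _) (x∈N , x∉VT)

  split-unique : Unique (processed ++ (w ∷ rest ++ Q'))
  split-unique = subst Unique tree-split tree-unique

  w∈VT : w ∈ VT
  w∈VT = subst (w ∈_) (sym tree-split) (∈-++⁺ʳ processed (here refl))

  w∉processed : w ∉ processed
  w∉processed w∈ = ++⁻-disjoint processed split-unique (w∈ , here refl)

  L-≢w : ∀ {x} → x ∈ L → x ≢ w
  L-≢w x∈L refl = L#VT (x∈L , w∈VT)

  L-uncoloured : ∀ {x c} → x ∈ L → s′ x ≢ just c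
  L-uncoloured x∈L sx
    with trans (sym sx) (trans (update-≢ s w k (L-≢w x∈L)) (unprocessed-uncoloured λ x∈ →
           L#VT (x∈L , subst (_ ∈_) (sym tree-split) (∈-++⁺ˡ x∈))))
  ... | ()

  ∈-ET′⁻ : ∀ {p v} → (p , v) ∈ ET′ → (p , v) ∈ ET ⊎ (p ≡ w × v ∈ L)
  ∈-ET′⁻ = ∈-++-map⁻ {E = ET} {w} {L}

  new-edge : ∀ {x} → x ∈ L → (w , x) ∈ ET′
  new-edge x∈L = ∈-++⁺ʳ ET (∈-map⁺ _ x∈L)

  old-parent-colour : ∀ {p v a} → (p , v) ∈ ET → s′ p ≡ just a → s p ≡ just a
  old-parent-colour pv sp =
    trans (sym (update-≢ s w k λ { refl → w∉processed (parent-processed pv) })) sp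

  levelling′ : Levelling r VT′ ET′ (extended-level levelling w∈VT L#VT)
  levelling′ = Levelling-extend levelling w∈VT L#VT

  k-avoids : ∀ {c} → InK G r ET′ s w c → c ≢ k
  k-avoids c∈K refl = proj₁ (proj₂ k-least) c∈K

  k-avoids-parent-nbhd : ∀ {p y c} → (p , w) ∈ ET → InClosedNbhd G p y → s y ≡ just c → c ≢ k
  k-avoids-parent-nbhd pw y∈N sy =
    k-avoids (inj₁ (_ , edge⇒parent levelling′ (∈-++⁺ˡ pw) , _ , y∈N , sy))

  k-avoids-nontree-parent : ∀ {x p c}
    → Adj G w x → ¬ TEdge ET′ w x → (p , x) ∈ ET → s p ≡ just c → c ≢ k
  k-avoids-nontree-parent wx ¬wx px sp =
    k-avoids (inj₂ (_ , inj₂ wx , (λ x≡w → Adj⇒≢ G wx (sym x≡w)) , ¬wx ,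
                    _ , edge⇒parent levelling′ (∈-++⁺ˡ px) , sp))

  down-apart-new : ∀ {p v a} → (p , v) ∈ ET → Adj G w v → s p ≡ just a → a ≢ k
  down-apart-new {v = v} pv wv sp with (w , v) ∈ᴱ? ET′ | (v , w) ∈ᴱ? ET′
  ... | yes wv∈ | _ with ∈-ET′⁻ wv∈
  ...   | inj₁ wv∈ET = ⊥-elim (w∉processed (parent-processed wv∈ET))
  ...   | inj₂ (_ , v∈L) = ⊥-elim (L#VT (v∈L , edge-target pv))
  down-apart-new pv wv sp | no _ | yes vw∈ with ∈-ET′⁻ vw∈
  ...   | inj₁ vw∈ET = k-avoids-parent-nbhd vw∈ET (inj₂ (Adj-sym G (tree-edge-adjacent pv))) sp
  ...   | inj₂ (refl , w∈L) = ⊥-elim (L#VT (w∈L , w∈VT))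
  down-apart-new pv wv sp | no ¬wv | no ¬vw =
    k-avoids-nontree-parent wv (λ { (inj₁ e) → ¬wv e ; (inj₂ e) → ¬vw e }) pv sp

  up-apart-new : ∀ {p v a} → (p , v) ∈ ET → Adj G w p → s v ≡ just a → a ≢ k
  up-apart-new {p} pv wp sv with (p , w) ∈ᴱ? ET
  ... | yes pw = k-avoids-parent-nbhd pw (inj₂ (tree-edge-adjacent pv)) sv
  ... | no ¬pw = ⊥-elim (precedes-++⁻ processed split-unique
          (subst (λ vt → Precedes vt w _) tree-split (nontree-precedes w pv (Adj-sym G wp) ¬pw))
          (coloured⇒processed sv) (here refl))

  tree-split′ : VT′ ≡ processed′ ++ (rest ++ (Q' ++ L))
  tree-split′ = begin
    VT ++ L                                   ≡⟨ cong (_++ L) tree-split ⟩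
    (processed ++ (w ∷ rest ++ Q')) ++ L      ≡⟨ ++-assoc processed _ L ⟩
    processed ++ (w ∷ (rest ++ Q') ++ L)
      ≡⟨ cong (λ q → processed ++ (w ∷ q)) (++-assoc rest Q' L) ⟩
    processed ++ (w ∷ rest ++ (Q' ++ L))      ≡⟨ ++-assoc processed (w ∷ []) _ ⟨
    processed′ ++ (rest ++ (Q' ++ L))         ∎
    where open ≡-Reasoning

  processed-coloured′ : ∀ {x} → x ∈ processed′ → ∃[ c ] (s′ x ≡ just c × 1 ≤ c)
  processed-coloured′ x∈ with ∈-++⁻ processed x∈
  ... | inj₁ x∈P with processed-coloured x∈P
  ...   | c , sx , 1≤c = c , trans (update-≢ s w k λ { refl → w∉processed x∈P }) sx , 1≤c
  processed-coloured′ x∈ | inj₂ (here refl) = k , update-≡ s w k , proj₁ k-least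

  unprocessed-uncoloured′ : ∀ {x} → x ∉ processed′ → s′ x ≡ nothing
  unprocessed-uncoloured′ x∉ =
    trans (update-≢ s w k λ { refl → x∉ (∈-++⁺ʳ processed (here refl)) })
          (unprocessed-uncoloured λ x∈ → x∉ (∈-++⁺ˡ x∈))

  parent-processed′ : ∀ {p v} → (p , v) ∈ ET′ → p ∈ processed′
  parent-processed′ e with ∈-ET′⁻ e
  ... | inj₁ pv = ∈-++⁺ˡ (parent-processed pv)
  ... | inj₂ (refl , _) = ∈-++⁺ʳ processed (here refl)

  tree-edge-adjacent′ : ∀ {p v} → (p , v) ∈ ET′ → Adj G p v
  tree-edge-adjacent′ e with ∈-ET′⁻ e
  ... | inj₁ pv = tree-edge-adjacent pv
  ... | inj₂ (refl , v∈L) with L⊆N[w] v∈L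
  ...   | inj₁ refl = ⊥-elim (L-≢w v∈L refl)
  ...   | inj₂ wv = wv

  processed-closed′ : ∀ {y} x → y ∈ processed′ → Adj G y x → x ∈ VT′
  processed-closed′ x y∈ yx with ∈-++⁻ processed y∈
  ... | inj₁ y∈P = ∈-++⁺ˡ (processed-closed x y∈P yx)
  ... | inj₂ (here refl) with x ∈? VT
  ...   | yes x∈VT = ∈-++⁺ˡ x∈VT
  ...   | no x∉VT = ∈-++⁺ʳ VT (N[w]∖VT⊆L (inj₂ yx) x∉VT)

  nontree-precedes′ : ∀ {p v} x → (p , v) ∈ ET′ → Adj G p x → (p , x) ∉ ET′
    → Precedes VT′ x v
  nontree-precedes′ x e px ¬px with ∈-ET′⁻ e
  ... | inj₁ pv = precedes-++ʳ L (nontree-precedes x pv px λ px∈ → ¬px (∈-++⁺ˡ px∈))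
  ... | inj₂ (refl , v∈L) with x ∈? VT
  ...   | yes x∈VT = VT , L , refl , x∈VT , v∈L
  ...   | no x∉VT = ⊥-elim (¬px (new-edge (N[w]∖VT⊆L (inj₂ px) x∉VT)))

  parent-apart′ : ∀ {p v} → (p , v) ∈ ET′ → Apart s′ p v
  parent-apart′ {v = v} e a b sp sv with ∈-ET′⁻ e
  ... | inj₂ (refl , v∈L) = ⊥-elim (L-uncoloured v∈L sv)
  ... | inj₁ pv with update⁻ s w k v sv
  ...   | inj₁ (refl , refl) = k-avoids-parent-nbhd pv (inj₁ refl) (old-parent-colour pv sp)
  ...   | inj₂ (_ , sv₀) = parent-apart pv a b (old-parent-colour pv sp) sv₀

  down-apart′ : ∀ {p v} x → (p , v) ∈ ET′ → Adj G x v → x ≢ p → Apart s′ p x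
  down-apart′ x e xv x≢p a b sp sx with ∈-ET′⁻ e
  ... | inj₂ (refl , v∈L) = ⊥-elim (L#VT (v∈L , processed-closed _
          (coloured⇒processed (trans (sym (update-≢ s w k x≢p)) sx)) xv))
  ... | inj₁ pv with update⁻ s w k x sx
  ...   | inj₁ (refl , refl) = down-apart-new pv xv (old-parent-colour pv sp)
  ...   | inj₂ (_ , sx₀) = down-apart x pv xv x≢p a b (old-parent-colour pv sp) sx₀

  up-apart′ : ∀ {p v} x → (p , v) ∈ ET′ → Adj G x p → x ≢ v → Apart s′ v x
  up-apart′ {v = v} x e xp x≢v a b sv sx with ∈-ET′⁻ e
  ... | inj₂ (refl , v∈L) = ⊥-elim (L-uncoloured v∈L sv)
  ... | inj₁ pv with update⁻ s w k v sv | update⁻ s w k x sx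
  ...   | inj₁ (refl , _) | inj₁ (refl , _) = ⊥-elim (x≢v refl)
  ...   | inj₁ (refl , refl) | inj₂ (_ , sx₀) =
          λ k≡b → k-avoids-parent-nbhd pv (inj₂ (Adj-sym G xp)) sx₀ (sym k≡b)
  ...   | inj₂ (_ , sv₀) | inj₁ (refl , refl) = up-apart-new pv xp sv₀
  ...   | inj₂ (_ , sv₀) | inj₂ (_ , sx₀) = up-apart x pv xp x≢v a b sv₀ sx₀

  invariant′ : Invariant G r (mkState rest (Q' ++ L) VT′ ET′ s′)
  invariant′ = record
    { processed = processed′ ; level = extended-level levelling w∈VT L#VT
    ; tree-split = tree-split′
    ; tree-unique = ++⁺ tree-unique L-unique λ (x∈VT , x∈L) → L#VT (x∈L , x∈VT)
    ; processed-coloured = processed-coloured′ ; unprocessed-uncoloured = unprocessed-uncoloured′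
    ; levelling = levelling′ ; parent-processed = parent-processed′
    ; tree-edge-adjacent = tree-edge-adjacent′ ; processed-closed = processed-closed′
    ; nontree-precedes = nontree-precedes′ ; parent-apart = parent-apart′
    ; down-apart = down-apart′ ; up-apart = up-apart′ }

step-invariant : ∀ {n} {G : Graph n} {r a b} → Step G r a b → Invariant G r a → Invariant G r b
step-invariant (process L k L-unique L-spec k-least) I =
  Process.invariant′ L k L-unique L-spec k-least I
step-invariant swap = swap-invariant

run-invariant : ∀ {n} {G : Graph n} {r a b} → Star (Step G r) a b → Invariant G r a → Invariant G r b
run-invariant ε I = I
run-invariant (move ◅ moves) I = run-invariant moves (step-invariant move I)

-- The terminal state

module Terminal {n} {G : Graph n} {r : Fin n} {fin : State n} (I : Invariant G r fin)
  (Q≡[] : Q fin ≡ []) (Q'≡[] : Q' fin ≡ []) (connected : IsConnected G) where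

  open Invariant I
  open Levelling levelling

  tree⊆processed : ∀ {x} → x ∈ VT fin → x ∈ processed
  tree⊆processed = subst (_ ∈_) (begin
    VT fin                                ≡⟨ tree-split ⟩
    processed ++ (Q fin ++ Q' fin)        ≡⟨ cong (λ q → processed ++ (q ++ Q' fin)) Q≡[] ⟩
    processed ++ Q' fin                   ≡⟨ cong (processed ++_) Q'≡[] ⟩
    processed ++ []                       ≡⟨ ++-identityʳ processed ⟩
    processed                             ∎)
    where open ≡-Reasoning

  tree-closed : ∀ {u x xs} → Chain (Adj G) u x xs → u ∈ VT fin → x ∈ VT fin
  tree-closed here u∈ = u∈
  tree-closed (step ux c) u∈ = tree-closed c (processed-closed _ (tree⊆processed u∈) ux)

  tree-spanning : ∀ x → x ∈ VT fin
  tree-spanning x = tree-closed (proj₂ (connected r x)) root∈V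

  colour : Fin n → ℕ
  colour x = proj₁ (processed-coloured (tree⊆processed (tree-spanning x)))

  colour-spec : ∀ x → s fin x ≡ just (colour x) × 1 ≤ colour x
  colour-spec x = proj₂ (processed-coloured (tree⊆processed (tree-spanning x)))

  ℓ : Fin n → ℤ
  ℓ x = + colour x

  apart : ∀ {x y} → Apart (s fin) x y → ℓ x ≢ ℓ y
  apart xy ℓx≡ℓy = xy _ _ (proj₁ (colour-spec _)) (proj₁ (colour-spec _)) (+-injective ℓx≡ℓy)

  bidirectional : Bidirectional G ℓ (ET fin)
  bidirectional p v pv =
    (tree-edge-adjacent pv , apart (parent-apart pv) , λ x x≢p xv → apart (down-apart x pv xv x≢p)) ,
    (Adj-sym G (tree-edge-adjacent pv) , (λ ℓv≡ℓp → apart (parent-apart pv) (sym ℓv≡ℓp)) ,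
      λ x x≢v xp → apart (up-apart x pv xp x≢v))

  tree-edge-nonconflicting : ∀ {a b} → TEdge (ET fin) a b → NonConflicting G ℓ a b
  tree-edge-nonconflicting (inj₁ ab) = proj₁ (bidirectional _ _ ab)
  tree-edge-nonconflicting (inj₂ ba) = proj₂ (bidirectional _ _ ba)

  tree-path : ∀ u v → ∃[ xs ] Chain (TEdge (ET fin)) u v xs
  tree-path u v = Chain-++ (proj₂ (to-root u)) (proj₂ (Chain-reverse TEdge-sym (proj₂ (to-root v))))
    where
    to-root : ∀ x → ∃[ xs ] Chain (TEdge (ET fin)) x r xs
    to-root x = TWalk⇒Chain (walk-root (tree-spanning x))

  pseudo-schedule : PseudoSchedule G ℓ
  pseudo-schedule u v _ with Chain-eraseLoops (proj₂ (tree-path u v))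
  ... | ys , u⇝v , unique = ys , Chain-map tree-edge-nonconflicting u⇝v , unique

theorem1 : ∀ {n} (G : Graph n) → IsConnected G → (r : Fin n) → (fin : State n)
    → Run G r fin
    → Σ (Fin n → ℕ) (λ l → (∀ v → s fin v ≡ just (l v) × 1 ≤ l v)
        × HPseudoSchedule G (ET fin) (λ v → + (l v)))
theorem1 G connected r fin (run , Q≡[] , Q'≡[]) =
  colour , colour-spec , pseudo-schedule , bidirectional
  where open Terminal (run-invariant run (initial-invariant G r)) Q≡[] Q'≡[] connected
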